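{- Let $d \geq 0$ and $n \geq 0$ be integers, and let $(F_j)_{j\geq 0}$ be the Fibonacci sequence. Then there exists an integer $m \geq 0$ with \[ F_n + F_{n+1} + \cdots + F_{n+d} = F_m \] if and only if either $d \in \{0,1\}$, or $d = 2$ and $n = 0$.
   Context: The Fibonacci sequence is defined by $F_0=0$, $F_1=1$, $F_{j+2}=F_{j+1}+F_j$ for $j\geq 0$. -}

module Defs where

open import Data.Nat using (ℕ; zero; suc; _+_)

fib : ℕ → ℕ
fib zero = 0
fib (suc zero) = 1
fib (suc (suc j)) = fib (suc j) + fib j

fibBlockSum : ℕ → ℕ → ℕ
fibBlockSum n zero = fib n
fibBlockSum n (suc d) = fibBlockSum n d + fib (n + suc d)

{-# OPTIONS --safe #-}
module Submission where

-- Write S = F n + ⋯ + F (n+d) and N = n + d.  Telescoping gives S + F (n+1) = F (N+2).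
-- Since 0 < F (n+1) this puts S below F (N+2); since F (N+2) = F (N+1) + F N and
-- F (n+1) < F N once d ≥ 2 and N ≥ 3, it puts S above F (N+1).  A number strictly
-- between consecutive Fibonacci numbers is not a Fibonacci number, because F is monotone.

open import Defs
open import Data.Nat using (ℕ; zero; suc; _+_; _≤_; _<_; _≤′_; z≤n; s≤s; ≤′-refl; ≤′-step)
open import Data.Nat.Properties
open import Algebra.Properties.CommutativeSemigroup +-commutativeSemigroup using (xy∙z≈xz∙y)
open import Data.Product using (∃; _×_; _,_)
open import Data.Sum using (_⊎_; inj₁; inj₂)
open import Data.Empty using (⊥-elim)
open import Relation.Nullary using (yes; no)
open import Relation.Binary.PropositionalEquality
open import Function.Bundles using (_⇔_; mk⇔)

fib≤fib[1+n] : ∀ n → fib n ≤ fib (suc n)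
fib≤fib[1+n] zero          = z≤n
fib≤fib[1+n] (suc zero)    = ≤-refl
fib≤fib[1+n] (suc (suc n)) = m≤m+n _ _

fib-mono-≤ : ∀ {m n} → m ≤ n → fib m ≤ fib n
fib-mono-≤ m≤n = mono′ (≤⇒≤′ m≤n)
  where
  mono′ : ∀ {m n} → m ≤′ n → fib m ≤ fib n
  mono′ ≤′-refl                   = ≤-refl
  mono′ {n = suc n} (≤′-step m≤n) = ≤-trans (mono′ m≤n) (fib≤fib[1+n] n)

fib[1+n]>0 : ∀ n → 0 < fib (suc n)
fib[1+n]>0 zero    = s≤s z≤n
fib[1+n]>0 (suc n) = ≤-trans (fib[1+n]>0 n) (m≤m+n _ _)

fib-mono-< : ∀ {m n} → m < n → 3 ≤ n → fib m < fib n
fib-mono-< {n = suc (suc (suc k))} (s≤s m≤2+k) _ =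
  ≤-<-trans (fib-mono-≤ m≤2+k) (m<m+n _ (fib[1+n]>0 k))
fib-mono-< {n = 1} _ (s≤s ())
fib-mono-< {n = 2} _ (s≤s (s≤s ()))

fib[k]<x<fib[1+k]⇒x≢fib : ∀ {k x} → fib k < x → x < fib (suc k) → ∀ m → x ≢ fib m
fib[k]<x<fib[1+k]⇒x≢fib {k} fib[k]<x x<fib[1+k] m refl with m ≤? k
... | yes m≤k = <-irrefl refl (≤-<-trans (fib-mono-≤ m≤k) fib[k]<x)
... | no  m≰k = <-irrefl refl (<-≤-trans x<fib[1+k] (fib-mono-≤ (≰⇒> m≰k)))

fibBlockSum+fib[1+n]≡fib[2+n+d] : ∀ n d → fibBlockSum n d + fib (suc n) ≡ fib (suc (suc (n + d)))
fibBlockSum+fib[1+n]≡fib[2+n+d] n zero    rewrite +-identityʳ n = +-comm (fib n) (fib (suc n))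
fibBlockSum+fib[1+n]≡fib[2+n+d] n (suc d) rewrite +-suc n d = begin
  fibBlockSum n d + fib (suc (n + d)) + fib (suc n)   ≡⟨ xy∙z≈xz∙y (fibBlockSum n d) _ _ ⟩
  fibBlockSum n d + fib (suc n) + fib (suc (n + d))   ≡⟨ cong (_+ fib (suc (n + d))) (fibBlockSum+fib[1+n]≡fib[2+n+d] n d) ⟩
  fib (suc (suc (n + d))) + fib (suc (n + d))         ∎
  where open ≡-Reasoning

fibBlockSum<fib[2+n+d] : ∀ n d → fibBlockSum n d < fib (suc (suc (n + d)))
fibBlockSum<fib[2+n+d] n d =
  subst (fibBlockSum n d <_) (fibBlockSum+fib[1+n]≡fib[2+n+d] n d) (m<m+n _ (fib[1+n]>0 n))

fib[1+n+d]<fibBlockSum : ∀ n d → 2 ≤ d → 3 ≤ n + d → fib (suc (n + d)) < fibBlockSum n d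
fib[1+n+d]<fibBlockSum n d 2≤d 3≤n+d = +-cancelˡ-< (fib (suc n)) _ _ (begin-strict
  fib (suc n) + fib (suc (n + d))       <⟨ +-monoˡ-< _ (fib-mono-< 1+n<n+d 3≤n+d) ⟩
  fib (n + d) + fib (suc (n + d))       ≡⟨ +-comm (fib (n + d)) (fib (suc (n + d))) ⟩
  fib (suc (suc (n + d)))               ≡⟨ sym (fibBlockSum+fib[1+n]≡fib[2+n+d] n d) ⟩
  fibBlockSum n d + fib (suc n)         ≡⟨ +-comm (fibBlockSum n d) _ ⟩
  fib (suc n) + fibBlockSum n d         ∎)
  where
  open ≤-Reasoning
  1+n<n+d : suc n < n + d
  1+n<n+d = subst (_≤ n + d) (+-comm n 2) (+-monoʳ-≤ n 2≤d)

fibBlockSum≢fib : ∀ n d → 2 ≤ d → 3 ≤ n + d → ∀ m → fibBlockSum n d ≢ fib m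
fibBlockSum≢fib n d 2≤d 3≤n+d =
  fib[k]<x<fib[1+k]⇒x≢fib {k = suc (n + d)} (fib[1+n+d]<fibBlockSum n d 2≤d 3≤n+d) (fibBlockSum<fib[2+n+d] n d)

proposition3p1 : (d n : ℕ) →
    (∃ λ m → fibBlockSum n d ≡ fib m) ⇔ ((d ≡ 0 ⊎ d ≡ 1) ⊎ (d ≡ 2 × n ≡ 0))
proposition3p1 d n = mk⇔ (only-if d n) (if d n)
  where
  only-if : ∀ d n → (∃ λ m → fibBlockSum n d ≡ fib m) → (d ≡ 0 ⊎ d ≡ 1) ⊎ (d ≡ 2 × n ≡ 0)
  only-if 0             _       _        = inj₁ (inj₁ refl)
  only-if 1             _       _        = inj₁ (inj₂ refl)
  only-if 2             zero    _        = inj₂ (refl , refl)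
  only-if 2             (suc n) (m , eq) = ⊥-elim (fibBlockSum≢fib (suc n) 2 ≤-refl (s≤s (m≤n+m 2 n)) m eq)
  only-if d@(suc (suc (suc e))) n (m , eq) =
    ⊥-elim (fibBlockSum≢fib n d (s≤s (s≤s z≤n)) (≤-trans (m≤m+n 3 e) (m≤n+m d n)) m eq)

  if : ∀ d n → (d ≡ 0 ⊎ d ≡ 1) ⊎ (d ≡ 2 × n ≡ 0) → ∃ λ m → fibBlockSum n d ≡ fib m
  if _ n (inj₁ (inj₁ refl))  = n , refl
  if _ n (inj₁ (inj₂ refl))  = suc (suc n) , trans (cong (λ j → fib n + fib j) (+-comm n 1)) (+-comm (fib n) _)
  if _ _ (inj₂ (refl , refl)) = 3 , refl
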